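{- Let $X$ be a finite set and equip $\mathrm{Par}X\times S_X$ with the uniform probability. Then the random variables $(\pi,\alpha)\mapsto |D_{\pi,\alpha}|$ and $(\pi,\alpha)\mapsto |I_{\pi,\alpha}|$ have the same mean.
   Context: $\mathrm{Par}X$ is the set of partitions of $X$ and $S_X$ the set of permutations of $X$. For a partition $\pi$ of $X$ and $i\in X$, let $|i|$ denote the cardinality of the block of $\pi$ containing $i$, and $S(i)=\ln|i|$. For $\alpha\in S_X$, $D_{\pi,\alpha}=\{i\in X: S(\alpha(i))<S(i)\}$ and $I_{\pi,\alpha}=\{i\in X: S(\alpha(i))>S(i)\}$. -}

module Defs where

open import Data.Bool using (Bool; true; false; _∧_; _∨_; not; if_then_else_)
open import Data.Nat using (ℕ; zero; suc; _<ᵇ_)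
open import Data.Fin using (Fin; zero; suc; _≟_)
open import Data.List using (List; []; _∷_; map; concatMap; filterᵇ; length; allFin; cartesianProduct)
open import Data.Bool.ListAction using (and; or)
open import Data.Nat.ListAction using (sum)
open import Data.Product using (_×_; _,_)
open import Relation.Nullary using (does)

-- The finite set X is modelled as Fin n (statement is invariant under bijection).

allFuns : {A : Set} → (m : ℕ) → List A → List (Fin m → A)
allFuns zero    xs = (λ ()) ∷ []
allFuns (suc m) xs =
  concatMap (λ a → map (λ f → λ { zero → a ; (suc i) → f i }) (allFuns m xs)) xs

_==_ : {n : ℕ} → Fin n → Fin n → Bool
i == j = does (i ≟ j)

allᶠ : {n : ℕ} → (Fin n → Bool) → Bool
allᶠ {n} p = and (map p (allFin n))

anyᶠ : {n : ℕ} → (Fin n → Bool) → Bool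
anyᶠ {n} p = or (map p (allFin n))

_⇒ᵇ_ : Bool → Bool → Bool
a ⇒ᵇ b = not a ∨ b

-- A partition of Fin n is represented by its equivalence relation
-- ("i and j lie in the same block"), a Boolean relation that is
-- reflexive, symmetric and transitive.
Rel : ℕ → Set
Rel n = Fin n → Fin n → Bool

isEquivalence : {n : ℕ} → Rel n → Bool
isEquivalence R =
  allᶠ (λ i → R i i) ∧
  (allᶠ (λ i → allᶠ (λ j → R i j ⇒ᵇ R j i)) ∧
   allᶠ (λ i → allᶠ (λ j → allᶠ (λ k → (R i j ∧ R j k) ⇒ᵇ R i k))))

Par : (n : ℕ) → List (Rel n)
Par n = filterᵇ isEquivalence (allFuns n (allFuns n (true ∷ false ∷ [])))

isBijection : {n : ℕ} → (Fin n → Fin n) → Bool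
isBijection α =
  allᶠ (λ i → allᶠ (λ j → (α i == α j) ⇒ᵇ (i == j))) ∧
  allᶠ (λ j → anyᶠ (λ i → α i == j))

Sym : (n : ℕ) → List (Fin n → Fin n)
Sym n = filterᵇ isBijection (allFuns n (allFin n))

blockSize : {n : ℕ} → Rel n → Fin n → ℕ
blockSize {n} π i = length (filterᵇ (π i) (allFin n))

-- S(i) = ln |i|; since ln is strictly increasing on positive integers,
-- S(α i) < S(i) iff |α i| < |i|.
-- |D_{π,α}| = #{ i : |α(i)| < |i| }
cardD : {n : ℕ} → Rel n → (Fin n → Fin n) → ℕ
cardD {n} π α = length (filterᵇ (λ i → blockSize π (α i) <ᵇ blockSize π i) (allFin n))

cardI : {n : ℕ} → Rel n → (Fin n → Fin n) → ℕ
cardI {n} π α = length (filterᵇ (λ i → blockSize π i <ᵇ blockSize π (α i)) (allFin n))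

ParSym : (n : ℕ) → List (Rel n × (Fin n → Fin n))
ParSym n = cartesianProduct (Par n) (Sym n)

-- Total of a random variable over the (uniform) sample space Par X × S_X.
-- The mean is this total divided by |Par X × S_X| (which is ≥ 1).
total : {n : ℕ} → (Rel n → (Fin n → Fin n) → ℕ) → ℕ
total {n} f = sum (map (λ { (π , α) → f π α }) (ParSym n))

module Submission where

-- For a fixed partition π, inversion α ↦ α⁻¹ is a bijection of S_X, and
-- i ↦ α(i) maps D_{π,α} bijectively onto I_{π,α⁻¹}, since
-- |α(i)| < |i| says exactly |j| < |α⁻¹(j)| for j = α(i).  Hence
-- Σ_α |D_{π,α}| = Σ_α |I_{π,α⁻¹}| = Σ_α |I_{π,α}|, and summing over π
-- gives the theorem (equal totals over the uniform space = equal means).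
--
-- Both
-- reindexings are then done with "Kronecker deltas":
-- Σ_j [i = j]·h(j) = h(i) over Fin n, and the analogous identity over the
-- list of all functions Fin m → Fin n (for h respecting pointwise
-- equality, as function extensionality is not available).

open import Defs
open import Algebra.Properties.CommutativeSemigroup using (interchange)
open import Data.Bool using (Bool; true; false; T; _∧_)
open import Data.Bool.ListAction using (and)
open import Data.Empty using (⊥-elim)
open import Data.Fin using (Fin; zero; suc)
open import Data.Fin.Properties using (_≟_; any?)
open import Data.List using (List; []; _∷_; _++_; map; concatMap; filterᵇ; length; allFin; cartesianProduct)
open import Data.List.Properties using (map-++; map-∘; map-tabulate)
open import Data.List.Membership.Propositional.Properties using (∈-allFin)
open import Data.List.Relation.Unary.All as All using ()
open import Data.List.Relation.Unary.All.Properties using (all⁺; all⁻)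
open import Data.List.Relation.Unary.Any as Any using ()
open import Data.List.Relation.Unary.Any.Properties using (any⁺; any⁻)
open import Data.Nat using (ℕ; zero; suc; _+_; _*_; _<ᵇ_)
open import Data.Nat.ListAction using (sum)
open import Data.Nat.ListAction.Properties using (sum-++)
open import Data.Nat.Properties using (+-identityʳ; *-identityˡ; *-identityʳ; *-zeroʳ; *-assoc; *-distribˡ-+; *-distribʳ-+; +-commutativeSemigroup)
open import Data.Product using (_×_; _,_; ∃; proj₁; proj₂)
open import Function using (_∘_; id)
open import Relation.Binary.PropositionalEquality
open import Relation.Nullary using (yes; no)

open ≡-Reasoning

∑ : {A : Set} → List A → (A → ℕ) → ℕ
∑ xs h = sum (map h xs)

∑-cong : {A : Set} (xs : List A) {h k : A → ℕ} → (∀ x → h x ≡ k x) → ∑ xs h ≡ ∑ xs k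
∑-cong []       e = refl
∑-cong (x ∷ xs) e = cong₂ _+_ (e x) (∑-cong xs e)

∑-zero : {A : Set} (xs : List A) → ∑ xs (λ _ → 0) ≡ 0
∑-zero []       = refl
∑-zero (x ∷ xs) = ∑-zero xs

∑-++ : {A : Set} (xs ys : List A) (h : A → ℕ) → ∑ (xs ++ ys) h ≡ ∑ xs h + ∑ ys h
∑-++ xs ys h = trans (cong sum (map-++ h xs ys)) (sum-++ (map h xs) (map h ys))

∑-map : {A B : Set} (g : A → B) (xs : List A) (h : B → ℕ) → ∑ (map g xs) h ≡ ∑ xs (h ∘ g)
∑-map g xs h = cong sum (sym (map-∘ xs))

∑-concatMap : {A B : Set} (f : A → List B) (xs : List A) (h : B → ℕ) →
              ∑ (concatMap f xs) h ≡ ∑ xs (λ x → ∑ (f x) h)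
∑-concatMap f []       h = refl
∑-concatMap f (x ∷ xs) h =
  trans (∑-++ (f x) (concatMap f xs) h) (cong (∑ (f x) h +_) (∑-concatMap f xs h))

∑-cartesianProduct : {A B : Set} (xs : List A) (ys : List B) (h : A × B → ℕ) →
                     ∑ (cartesianProduct xs ys) h ≡ ∑ xs (λ x → ∑ ys (λ y → h (x , y)))
∑-cartesianProduct []       ys h = refl
∑-cartesianProduct (x ∷ xs) ys h =
  trans (∑-++ (map (x ,_) ys) (cartesianProduct xs ys) h)
        (cong₂ _+_ (∑-map (x ,_) ys h) (∑-cartesianProduct xs ys h))

∑-+ : {A : Set} (xs : List A) (h k : A → ℕ) → ∑ xs (λ x → h x + k x) ≡ ∑ xs h + ∑ xs k
∑-+ []       h k = refl
∑-+ (x ∷ xs) h k =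
  trans (cong (h x + k x +_) (∑-+ xs h k))
        (interchange +-commutativeSemigroup (h x) (k x) (∑ xs h) (∑ xs k))

∑-swap : {A B : Set} (xs : List A) (ys : List B) (k : A → B → ℕ) →
         ∑ xs (λ x → ∑ ys (k x)) ≡ ∑ ys (λ y → ∑ xs (λ x → k x y))
∑-swap []       ys k = sym (∑-zero ys)
∑-swap (x ∷ xs) ys k =
  trans (cong (∑ ys (k x) +_) (∑-swap xs ys k)) (sym (∑-+ ys (k x) (λ y → ∑ xs (λ x → k x y))))

∑-*ˡ : {A : Set} (xs : List A) (c : ℕ) (h : A → ℕ) → ∑ xs (λ x → c * h x) ≡ c * ∑ xs h
∑-*ˡ []       c h = sym (*-zeroʳ c)
∑-*ˡ (x ∷ xs) c h = trans (cong (c * h x +_) (∑-*ˡ xs c h)) (sym (*-distribˡ-+ c (h x) _))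

∑-*ʳ : {A : Set} (xs : List A) (c : ℕ) (h : A → ℕ) → ∑ xs (λ x → h x * c) ≡ ∑ xs h * c
∑-*ʳ []       c h = refl
∑-*ʳ (x ∷ xs) c h = trans (cong (h x * c +_) (∑-*ʳ xs c h)) (sym (*-distribʳ-+ c (h x) _))

-- Indicator of a Boolean; filtering a list multiplies the summand by it,
-- which turns counts and restricted sums into full sums.
𝟙 : Bool → ℕ
𝟙 true  = 1
𝟙 false = 0

𝟙-∧ : (a b : Bool) → 𝟙 (a ∧ b) ≡ 𝟙 a * 𝟙 b
𝟙-∧ true  true  = refl
𝟙-∧ true  false = refl
𝟙-∧ false b     = refl

∑-filter : {A : Set} (p : A → Bool) (xs : List A) (h : A → ℕ) →
           ∑ (filterᵇ p xs) h ≡ ∑ xs (λ x → 𝟙 (p x) * h x)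
∑-filter p []       h = refl
∑-filter p (x ∷ xs) h with p x
... | true  = cong₂ _+_ (sym (+-identityʳ (h x))) (∑-filter p xs h)
... | false = ∑-filter p xs h

length-filter : {A : Set} (p : A → Bool) (xs : List A) → length (filterᵇ p xs) ≡ ∑ xs (𝟙 ∘ p)
length-filter p []       = refl
length-filter p (x ∷ xs) with p x
... | true  = cong suc (length-filter p xs)
... | false = length-filter p xs

∑-filter-cong : {A : Set} (p : A → Bool) (xs : List A) {h k : A → ℕ} →
                (∀ x → T (p x) → h x ≡ k x) → ∑ (filterᵇ p xs) h ≡ ∑ (filterᵇ p xs) k
∑-filter-cong p []       e = refl
∑-filter-cong p (x ∷ xs) e with p x in px
... | true  = cong₂ _+_ (e x (subst T (sym px) _)) (∑-filter-cong p xs e)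
... | false = ∑-filter-cong p xs e

T-ext : {a b : Bool} → (T a → T b) → (T b → T a) → a ≡ b
T-ext {true}  {true}  f g = refl
T-ext {true}  {false} f g = ⊥-elim (f _)
T-ext {false} {true}  f g = ⊥-elim (g _)
T-ext {false} {false} f g = refl

T-∧⁺ : {a b : Bool} → T a → T b → T (a ∧ b)
T-∧⁺ {true} _ t = t

T-∧⁻ : {a b : Bool} → T (a ∧ b) → T a × T b
T-∧⁻ {true} t = _ , t

⇒ᵇ⁺ : {a b : Bool} → (T a → T b) → T (a ⇒ᵇ b)
⇒ᵇ⁺ {true}  f = f _
⇒ᵇ⁺ {false} f = _

⇒ᵇ⁻ : {a b : Bool} → T (a ⇒ᵇ b) → T a → T b
⇒ᵇ⁻ {true} t _ = t

==⇒≡ : {n : ℕ} {i j : Fin n} → T (i == j) → i ≡ j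
==⇒≡ {i = i} {j} t with i ≟ j
... | yes i≡j = i≡j

≡⇒== : {n : ℕ} {i j : Fin n} → i ≡ j → T (i == j)
≡⇒== {i = i} refl with i ≟ i
... | yes _   = _
... | no i≢i = i≢i refl

allᶠ⁺ : {n : ℕ} (p : Fin n → Bool) → (∀ i → T (p i)) → T (allᶠ p)
allᶠ⁺ {n} p f = all⁻ p {xs = allFin n} (All.tabulate (λ {i} _ → f i))

allᶠ⁻ : {n : ℕ} (p : Fin n → Bool) → T (allᶠ p) → ∀ i → T (p i)
allᶠ⁻ {n} p t i = All.lookup (all⁺ p (allFin n) t) (∈-allFin i)

anyᶠ⁺ : {n : ℕ} (p : Fin n → Bool) (i : Fin n) → T (p i) → T (anyᶠ p)
anyᶠ⁺ p i t = any⁺ p (Any.map (λ i≡x → subst (T ∘ p) i≡x t) (∈-allFin i))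

anyᶠ⁻ : {n : ℕ} (p : Fin n → Bool) → T (anyᶠ p) → ∃ λ i → T (p i)
anyᶠ⁻ {n} p t = Any.satisfied (any⁻ p (allFin n) t)

_≐_ : {m n : ℕ} → (Fin m → Fin n) → (Fin m → Fin n) → Bool
f ≐ g = allᶠ (λ i → f i == g i)

≐⇒≗ : {m n : ℕ} {f g : Fin m → Fin n} → T (f ≐ g) → f ≗ g
≐⇒≗ t i = ==⇒≡ (allᶠ⁻ _ t i)

≗⇒≐ : {m n : ℕ} {f g : Fin m → Fin n} → f ≗ g → T (f ≐ g)
≗⇒≐ e = allᶠ⁺ _ (λ i → ≡⇒== (e i))

≐-congʳ : {m n : ℕ} (f : Fin m → Fin n) {g g′ : Fin m → Fin n} → g ≗ g′ → (f ≐ g) ≡ (f ≐ g′)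
≐-congʳ f {g} {g′} e =
  T-ext (λ t → ≗⇒≐ {f = f} {g′} (λ i → trans (≐⇒≗ {f = f} {g} t i) (e i)))
        (λ t → ≗⇒≐ {f = f} {g} (λ i → trans (≐⇒≗ {f = f} {g′} t i) (sym (e i))))

record IsBijective {n : ℕ} (α : Fin n → Fin n) : Set where
  field
    injective  : ∀ {i j} → α i ≡ α j → i ≡ j
    surjective : ∀ j → ∃ λ i → α i ≡ j
open IsBijective

isBijection-sound : {n : ℕ} (α : Fin n → Fin n) → T (isBijection α) → IsBijective α
isBijection-sound α t = record
  { injective  = λ {i} {j} αi≡αj →
      ==⇒≡ (⇒ᵇ⁻ (allᶠ⁻ _ (allᶠ⁻ _ (proj₁ (T-∧⁻ t)) i) j) (≡⇒== αi≡αj))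
  ; surjective = λ j → let (i , αi==j) = anyᶠ⁻ _ (allᶠ⁻ _ (proj₂ (T-∧⁻ t)) j) in i , ==⇒≡ αi==j
  }

isBijection-complete : {n : ℕ} (α : Fin n → Fin n) → IsBijective α → T (isBijection α)
isBijection-complete α B = T-∧⁺
  (allᶠ⁺ _ (λ i → allᶠ⁺ _ (λ j → ⇒ᵇ⁺ {α i == α j} (λ t → ≡⇒== (injective B (==⇒≡ t))))))
  (allᶠ⁺ _ (λ j → let (i , αi≡j) = surjective B j in anyᶠ⁺ _ i (≡⇒== αi≡j)))

IsBijective-resp : {n : ℕ} {α β : Fin n → Fin n} → α ≗ β → IsBijective α → IsBijective β
IsBijective-resp {α = α} {β} e B = record
  { injective  = λ {i} {j} βi≡βj → injective B (trans (e i) (trans βi≡βj (sym (e j))))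
  ; surjective = λ j → let (i , αi≡j) = surjective B j in i , trans (sym (e i)) αi≡j
  }

-- The inverse of α: some preimage of j when one exists (j itself otherwise).
inv : {n : ℕ} → (Fin n → Fin n) → Fin n → Fin n
inv α j with any? (λ i → α i ≟ j)
... | yes (i , _) = i
... | no _        = j

inv-right : {n : ℕ} {α : Fin n → Fin n} → IsBijective α → ∀ j → α (inv α j) ≡ j
inv-right {α = α} B j with any? (λ i → α i ≟ j)
... | yes (_ , αi≡j) = αi≡j
... | no ∄preimage   = ⊥-elim (∄preimage (surjective B j))

inv-unique : {n : ℕ} {α : Fin n → Fin n} → IsBijective α → ∀ {i j} → α i ≡ j → inv α j ≡ i
inv-unique B {j = j} αi≡j = injective B (trans (inv-right B j) (sym αi≡j))

inv-bijective : {n : ℕ} {α : Fin n → Fin n} → IsBijective α → IsBijective (inv α)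
inv-bijective {α = α} B = record
  { injective  = λ {i} {j} e → trans (sym (inv-right B i)) (trans (cong α e) (inv-right B j))
  ; surjective = λ i → α i , inv-unique B refl
  }

map-allFin-suc : {A : Set} {n : ℕ} (g : Fin (suc n) → A) →
                 map g (allFin (suc n)) ≡ g zero ∷ map (g ∘ suc) (allFin n)
map-allFin-suc g = cong (g zero ∷_) (trans (map-tabulate suc g) (sym (map-tabulate id (g ∘ suc))))

allᶠ-suc : {n : ℕ} (p : Fin (suc n) → Bool) → allᶠ p ≡ p zero ∧ allᶠ (p ∘ suc)
allᶠ-suc p = cong and (map-allFin-suc p)

∑-allFin-suc : {n : ℕ} (h : Fin (suc n) → ℕ) → ∑ (allFin (suc n)) h ≡ h zero + ∑ (allFin n) (h ∘ suc)
∑-allFin-suc h = cong sum (map-allFin-suc h)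

∑-delta-Fin : {n : ℕ} (i : Fin n) (h : Fin n → ℕ) → ∑ (allFin n) (λ j → 𝟙 (i == j) * h j) ≡ h i
∑-delta-Fin {suc n} zero h = begin
  ∑ (allFin (suc n)) (λ j → 𝟙 (zero == j) * h j) ≡⟨ ∑-allFin-suc (λ j → 𝟙 (zero == j) * h j) ⟩
  1 * h zero + ∑ (allFin n) (λ _ → 0)            ≡⟨ cong₂ _+_ (*-identityˡ (h zero)) (∑-zero (allFin n)) ⟩
  h zero + 0                                     ≡⟨ +-identityʳ (h zero) ⟩
  h zero                                         ∎
∑-delta-Fin {suc n} (suc i) h =
  trans (∑-allFin-suc (λ j → 𝟙 (suc i == j) * h j)) (∑-delta-Fin i (h ∘ suc))

Extensional : {m : ℕ} {A : Set} → ((Fin m → A) → ℕ) → Set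
Extensional h = ∀ {f g} → f ≗ g → h f ≡ h g

_◂_ : {m : ℕ} {A : Set} → A → (Fin m → A) → Fin (suc m) → A
(a ◂ g) zero    = a
(a ◂ g) (suc i) = g i

◂-cong : {m : ℕ} {A : Set} (a : A) {g g′ : Fin m → A} → g ≗ g′ → (a ◂ g) ≗ (a ◂ g′)
◂-cong a e zero    = refl
◂-cong a e (suc i) = e i

∑-allFuns-suc : {m : ℕ} {A : Set} (xs : List A) (h : (Fin (suc m) → A) → ℕ) → Extensional h →
                ∑ (allFuns (suc m) xs) h ≡ ∑ xs (λ a → ∑ (allFuns m xs) (λ g → h (a ◂ g)))
∑-allFuns-suc {m} {A} xs h ext = split _ (λ { _ _ zero → refl ; _ _ (suc i) → refl })
  where
  -- allFuns builds its functions with an anonymous cons; abstract over it.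
  split : (c : A → (Fin m → A) → Fin (suc m) → A) → (∀ a g → c a g ≗ (a ◂ g)) →
          ∑ (concatMap (λ a → map (c a) (allFuns m xs)) xs) h
            ≡ ∑ xs (λ a → ∑ (allFuns m xs) (λ g → h (a ◂ g)))
  split c c≗◂ = trans (∑-concatMap _ xs h) (∑-cong xs (λ a →
    trans (∑-map (c a) (allFuns m xs) h) (∑-cong (allFuns m xs) (λ g → ext (c≗◂ a g)))))

∑-delta-Fun : {m n : ℕ} (f : Fin m → Fin n) (h : (Fin m → Fin n) → ℕ) → Extensional h →
              ∑ (allFuns m (allFin n)) (λ g → 𝟙 (f ≐ g) * h g) ≡ h f
∑-delta-Fun {zero} f h ext =
  trans (+-identityʳ _) (trans (*-identityˡ _) (ext (λ ())))
∑-delta-Fun {suc m} {n} f h ext = begin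
  ∑ (allFuns (suc m) Fn) (λ g → 𝟙 (f ≐ g) * h g)
    ≡⟨ ∑-allFuns-suc Fn _ (λ e → cong₂ _*_ (cong 𝟙 (≐-congʳ f e)) (ext e)) ⟩
  ∑ Fn (λ a → ∑ Gs (λ g → 𝟙 (f ≐ (a ◂ g)) * h (a ◂ g)))
    ≡⟨ ∑-cong Fn (λ a → ∑-cong Gs (λ g → cong (_* h (a ◂ g)) (split-head a g))) ⟩
  ∑ Fn (λ a → ∑ Gs (λ g → 𝟙 (f zero == a) * 𝟙 (tail ≐ g) * h (a ◂ g)))
    ≡⟨ ∑-cong Fn (λ a → trans (∑-cong Gs (λ g → *-assoc (𝟙 (f zero == a)) _ _))
                              (∑-*ˡ Gs (𝟙 (f zero == a)) _)) ⟩
  ∑ Fn (λ a → 𝟙 (f zero == a) * ∑ Gs (λ g → 𝟙 (tail ≐ g) * h (a ◂ g)))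
    ≡⟨ ∑-cong Fn (λ a → cong (𝟙 (f zero == a) *_)
                             (∑-delta-Fun tail (λ g → h (a ◂ g)) (λ e → ext (◂-cong a e)))) ⟩
  ∑ Fn (λ a → 𝟙 (f zero == a) * h (a ◂ tail))
    ≡⟨ ∑-delta-Fin (f zero) (λ a → h (a ◂ tail)) ⟩
  h (f zero ◂ tail)
    ≡⟨ ext (λ { zero → refl ; (suc i) → refl }) ⟩
  h f ∎
  where
  Fn : List (Fin n)
  Fn = allFin n
  Gs : List (Fin m → Fin n)
  Gs = allFuns m Fn
  tail : Fin m → Fin n
  tail = f ∘ suc
  split-head : ∀ a g → 𝟙 (f ≐ (a ◂ g)) ≡ 𝟙 (f zero == a) * 𝟙 (tail ≐ g)
  split-head a g = trans (cong 𝟙 (allᶠ-suc (λ i → f i == (a ◂ g) i))) (𝟙-∧ (f zero == a) (tail ≐ g))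

inverse-equation : {n : ℕ} {g : Fin n → Fin n} → IsBijective g → (α : Fin n → Fin n) →
                   (isBijection α ∧ (inv α ≐ g)) ≡ (inv g ≐ α)
inverse-equation {g = g} Bg α = T-ext to from
  where
  to : T (isBijection α ∧ (inv α ≐ g)) → T (inv g ≐ α)
  to t with T-∧⁻ {isBijection α} t
  ... | bij , inv≐g = ≗⇒≐ {f = inv g} {α} (λ j →
    inv-unique Bg (trans (sym (≐⇒≗ {f = inv α} {g} inv≐g (α j)))
                         (inv-unique (isBijection-sound α bij) refl)))
  from : T (inv g ≐ α) → T (isBijection α ∧ (inv α ≐ g))
  from t = T-∧⁺ (isBijection-complete α Bα) (≗⇒≐ {f = inv α} {g} (λ j →
    inv-unique Bα (trans (sym (inv≗α (g j))) (inv-unique Bg refl))))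
    where
    inv≗α : inv g ≗ α
    inv≗α = ≐⇒≗ {f = inv g} {α} t
    Bα : IsBijective α
    Bα = IsBijective-resp inv≗α (inv-bijective Bg)

inverse-count : {n : ℕ} (g : Fin n → Fin n) →
                ∑ (allFuns n (allFin n)) (λ α → 𝟙 (isBijection α ∧ (inv α ≐ g))) ≡ 𝟙 (isBijection g)
inverse-count {n} g with isBijection g in bij-g
... | true  = begin
  ∑ Fs (λ α → 𝟙 (isBijection α ∧ (inv α ≐ g)))
    ≡⟨ ∑-cong Fs (λ α → trans (cong 𝟙 (inverse-equation Bg α)) (sym (*-identityʳ _))) ⟩
  ∑ Fs (λ α → 𝟙 (inv g ≐ α) * 1)
    ≡⟨ ∑-delta-Fun (inv g) (λ _ → 1) (λ _ → refl) ⟩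
  1 ∎
  where
  Fs : List (Fin n → Fin n)
  Fs = allFuns n (allFin n)
  Bg : IsBijective g
  Bg = isBijection-sound g (subst T (sym bij-g) _)
... | false = trans (∑-cong (allFuns n (allFin n)) no-inverse) (∑-zero (allFuns n (allFin n)))
  where
  no-inverse : ∀ α → 𝟙 (isBijection α ∧ (inv α ≐ g)) ≡ 0
  no-inverse α = cong 𝟙 (T-ext (λ t → subst T bij-g (isBijection-complete g (g-bijective t))) λ ())
    where
    g-bijective : T (isBijection α ∧ (inv α ≐ g)) → IsBijective g
    g-bijective t with T-∧⁻ {isBijection α} t
    ... | bij , inv≐g = IsBijective-resp (≐⇒≗ {f = inv α} {g} inv≐g)
                                         (inv-bijective (isBijection-sound α bij))

∑-Sym-inv : {n : ℕ} (h : (Fin n → Fin n) → ℕ) → Extensional h →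
            ∑ (Sym n) (h ∘ inv) ≡ ∑ (Sym n) h
∑-Sym-inv {n} h ext = begin
  ∑ (Sym n) (h ∘ inv)
    ≡⟨ ∑-filter isBijection Fs (h ∘ inv) ⟩
  ∑ Fs (λ α → 𝟙 (isBijection α) * h (inv α))
    ≡⟨ ∑-cong Fs (λ α → cong (𝟙 (isBijection α) *_) (sym (∑-delta-Fun (inv α) h ext))) ⟩
  ∑ Fs (λ α → 𝟙 (isBijection α) * ∑ Fs (λ g → 𝟙 (inv α ≐ g) * h g))
    ≡⟨ ∑-cong Fs (λ α → sym (∑-*ˡ Fs (𝟙 (isBijection α)) _)) ⟩
  ∑ Fs (λ α → ∑ Fs (λ g → 𝟙 (isBijection α) * (𝟙 (inv α ≐ g) * h g)))
    ≡⟨ ∑-swap Fs Fs _ ⟩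
  ∑ Fs (λ g → ∑ Fs (λ α → 𝟙 (isBijection α) * (𝟙 (inv α ≐ g) * h g)))
    ≡⟨ ∑-cong Fs (λ g → ∑-cong Fs (λ α → merge α g)) ⟩
  ∑ Fs (λ g → ∑ Fs (λ α → 𝟙 (isBijection α ∧ (inv α ≐ g)) * h g))
    ≡⟨ ∑-cong Fs (λ g → trans (∑-*ʳ Fs (h g) _) (cong (_* h g) (inverse-count g))) ⟩
  ∑ Fs (λ g → 𝟙 (isBijection g) * h g)
    ≡⟨ sym (∑-filter isBijection Fs h) ⟩
  ∑ (Sym n) h ∎
  where
  Fs : List (Fin n → Fin n)
  Fs = allFuns n (allFin n)
  merge : ∀ α g → 𝟙 (isBijection α) * (𝟙 (inv α ≐ g) * h g) ≡ 𝟙 (isBijection α ∧ (inv α ≐ g)) * h g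
  merge α g = trans (sym (*-assoc (𝟙 (isBijection α)) _ _))
                    (cong (_* h g) (sym (𝟙-∧ (isBijection α) (inv α ≐ g))))

count : {n : ℕ} → (Fin n → Bool) → ℕ
count {n} p = length (filterᵇ p (allFin n))

count-cong : {n : ℕ} {p q : Fin n → Bool} → (∀ i → p i ≡ q i) → count p ≡ count q
count-cong {n} {p} {q} e = begin
  count p                  ≡⟨ length-filter p (allFin n) ⟩
  ∑ (allFin n) (𝟙 ∘ p)     ≡⟨ ∑-cong (allFin n) (cong 𝟙 ∘ e) ⟩
  ∑ (allFin n) (𝟙 ∘ q)     ≡⟨ sym (length-filter q (allFin n)) ⟩
  count q                  ∎

graph-inv : {n : ℕ} {α : Fin n → Fin n} → IsBijective α → ∀ i j → (α i == j) ≡ (inv α j == i)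
graph-inv {α = α} B i j =
  T-ext (λ t → ≡⇒== (inv-unique B (==⇒≡ t)))
        (λ t → ≡⇒== (trans (cong α (sym (==⇒≡ {i = inv α j} t))) (inv-right B j)))

-- i ↦ α(i) matches {i : R(α i, i)} with {j : R(j, α⁻¹ j)}.
count-exchange : {n : ℕ} {α : Fin n → Fin n} → IsBijective α → (R : Fin n → Fin n → Bool) →
                 count (λ i → R (α i) i) ≡ count (λ j → R j (inv α j))
count-exchange {n} {α} B R = begin
  count (λ i → R (α i) i)
    ≡⟨ length-filter _ F ⟩
  ∑ F (λ i → 𝟙 (R (α i) i))
    ≡⟨ ∑-cong F (λ i → sym (∑-delta-Fin (α i) (λ j → 𝟙 (R j i)))) ⟩
  ∑ F (λ i → ∑ F (λ j → 𝟙 (α i == j) * 𝟙 (R j i)))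
    ≡⟨ ∑-swap F F _ ⟩
  ∑ F (λ j → ∑ F (λ i → 𝟙 (α i == j) * 𝟙 (R j i)))
    ≡⟨ ∑-cong F (λ j → ∑-cong F (λ i → cong (λ b → 𝟙 b * 𝟙 (R j i)) (graph-inv B i j))) ⟩
  ∑ F (λ j → ∑ F (λ i → 𝟙 (inv α j == i) * 𝟙 (R j i)))
    ≡⟨ ∑-cong F (λ j → ∑-delta-Fin (inv α j) (λ i → 𝟙 (R j i))) ⟩
  ∑ F (λ j → 𝟙 (R j (inv α j)))
    ≡⟨ sym (length-filter _ F) ⟩
  count (λ j → R j (inv α j)) ∎
  where
  F : List (Fin n)
  F = allFin n

-- For each partition, D and I have the same total over S_X.  By definition
-- |D_{π,α}| = count (λ i → smaller (α i) i) and |I_{π,β}| = count (λ j → smaller j (β j)).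
∑-Sym-cardD≡cardI : {n : ℕ} (π : Rel n) → ∑ (Sym n) (cardD π) ≡ ∑ (Sym n) (cardI π)
∑-Sym-cardD≡cardI {n} π = begin
  ∑ (Sym n) (cardD π)
    ≡⟨ ∑-filter-cong isBijection (allFuns n (allFin n))
         (λ α bij → count-exchange (isBijection-sound α bij) smaller) ⟩
  ∑ (Sym n) (cardI π ∘ inv)
    ≡⟨ ∑-Sym-inv (cardI π) (λ e → count-cong (λ j → cong (smaller j) (e j))) ⟩
  ∑ (Sym n) (cardI π) ∎
  where
  smaller : Fin n → Fin n → Bool
  smaller i j = blockSize π i <ᵇ blockSize π j

mainTheorem2 : (n : ℕ) → total {n} cardD ≡ total {n} cardI
mainTheorem2 n = begin
  total {n} cardD                               ≡⟨ ∑-cartesianProduct (Par n) (Sym n) _ ⟩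
  ∑ (Par n) (λ π → ∑ (Sym n) (cardD π))         ≡⟨ ∑-cong (Par n) ∑-Sym-cardD≡cardI ⟩
  ∑ (Par n) (λ π → ∑ (Sym n) (cardI π))         ≡⟨ sym (∑-cartesianProduct (Par n) (Sym n) _) ⟩
  total {n} cardI                               ∎
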